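{- Let $n$ be a positive integer with $\gcd(n,6)=1$. If $(1)(n-4)(n-3)(6)$, respectively $(1)(n-3)(n-2)(4)$, is a minimal zero-sum sequence over $\mathbb{Z}/n$ with all entries in $[1,n)$, then it has index $1$.
   Context: A sequence is minimal zero-sum if its terms sum to $0$ and no proper nontrivial subsequence sums to $0$. For a generator $g$ of $\mathbb{Z}/n$, writing $S=(y_1g)\cdots(y_4g)$ with $1\le y_i\le n$, the $g$-norm is $\|S\|_g=\frac{1}{n}\sum y_i$, and $\mathrm{ind}(S)=\min_g\|S\|_g$ over all generators $g$. -}

module Defs where

open import Data.Nat using (ℕ; zero; suc; _+_; _*_; _∸_; _≤_; _<_; NonZero)
open import Data.Nat.DivMod using (_%_)
open import Data.Bool using (Bool; true; false)
open import Data.Vec using (Vec; []; _∷_; lookup; sum; replicate)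
open import Data.Fin using (Fin)
open import Data.Product using (_×_; ∃; ∃-syntax; Σ-syntax)
open import Relation.Binary.PropositionalEquality using (_≡_; _≢_)

-- Elements of ℤ/n are represented by natural numbers, taken modulo n.

-- Sum of the terms of a sequence selected by a Boolean mask
-- (a subsequence of S is given by choosing which positions to keep).
maskSum : ∀ {k} → Vec Bool k → Vec ℕ k → ℕ
maskSum [] [] = 0
maskSum (true ∷ bs) (x ∷ xs) = x + maskSum bs xs
maskSum (false ∷ bs) (x ∷ xs) = maskSum bs xs

ZeroSum : (n : ℕ) .{{_ : NonZero n}} → ∀ {k} → Vec ℕ k → Set
ZeroSum n S = sum S % n ≡ 0

MinimalZeroSum : (n : ℕ) .{{_ : NonZero n}} → ∀ {k} → Vec ℕ k → Set
MinimalZeroSum n {k} S =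
  ZeroSum n S ×
  ((m : Vec Bool k) → m ≢ replicate k false → m ≢ replicate k true →
     maskSum m S % n ≢ 0)

IsGenerator : (n : ℕ) .{{_ : NonZero n}} → ℕ → Set
IsGenerator n g = ∀ x → ∃[ c ] ((c * g) % n ≡ x % n)

IsCoord : (n : ℕ) .{{_ : NonZero n}} → ℕ → ℕ → ℕ → Set
IsCoord n g x y = (1 ≤ y) × (y ≤ n) × ((y * g) % n ≡ x % n)

-- GNormSum n g S s : writing S = (y₁g)⋯(y_k g) with 1 ≤ yᵢ ≤ n, s = Σ yᵢ,
-- i.e. ‖S‖_g = s / n.
GNormSum : (n : ℕ) .{{_ : NonZero n}} → ℕ → ∀ {k} → Vec ℕ k → ℕ → Set
GNormSum n g {k} S s =
  Σ[ ys ∈ Vec ℕ k ] ((∀ (i : Fin k) → IsCoord n g (lookup S i) (lookup ys i))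
                     × sum ys ≡ s)

-- ind(S) = min over generators g of ‖S‖_g equals 1:
-- the minimum value s/n = 1 is attained, and every generator gives s/n ≥ 1.
IndexOne : (n : ℕ) .{{_ : NonZero n}} → ∀ {k} → Vec ℕ k → Set
IndexOne n S =
  (∃[ g ] (IsGenerator n g × GNormSum n g S n)) ×
  (∀ g s → IsGenerator n g → GNormSum n g S s → n ≤ s)

EntriesIn : (n : ℕ) → ∀ {k} → Vec ℕ k → Set
EntriesIn n {k} S = ∀ (i : Fin k) → (1 ≤ lookup S i) × (lookup S i < n)

seqA : ℕ → Vec ℕ 4
seqA n = 1 ∷ (n ∸ 4) ∷ (n ∸ 3) ∷ 6 ∷ []

seqB : ℕ → Vec ℕ 4
seqB n = 1 ∷ (n ∸ 3) ∷ (n ∸ 2) ∷ 4 ∷ []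

-- Every generator g gives ‖S‖_g ≥ 1: the g-coordinates of a zero-sum sequence add up to a
-- positive multiple of n. So ind(S) = 1 as soon as one generator makes the coordinates add up
-- to exactly n. Since gcd(n,6) = 1, n mod 12 is 1, 5, 7 or 11, and in each class an explicit
-- generator does it: for (1)(n-4)(n-3)(6) take g = 6 if n ≡ 5 (mod 6) and g = -4 resp. -4/3
-- if n ≡ 1 resp. 7 (mod 12); for (1)(n-3)(n-2)(4) take g = 4 if n ≡ 3 (mod 4) and g = -3
-- resp. -3/2 if n ≡ 1 resp. 5 (mod 12). The only exceptions, n = 7 and n = 5 respectively,
-- are excluded because there 3 + 4 ≡ 0 resp. 2 + 3 ≡ 0 and the sequence is not minimal.
module Submission where

open import Data.Bool using (false; true)
open import Data.Fin using (Fin; zero; suc)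
import Data.List as List
open import Data.Nat using (ℕ; zero; suc; _+_; _*_; _≤_; _<_; NonZero; z≤n; s≤s; >-nonZero)
open import Data.Nat.Divisibility
  using (_∣_; divides; ∣-trans; ∣1⇒≡1; ∣m∣n⇒∣m+n; ∣n⇒∣m*n; m%n≡0⇒n∣m; ∣⇒≤)
open import Data.Nat.DivMod
  using (_%_; _/_; m≡m%n+[m/n]*n; m%n<n; [m+kn]%n≡m%n; %-distribˡ-+; %-distribˡ-*; m*n%n≡0)
open import Data.Nat.GCD using (gcd; gcd-greatest; gcd[m,n]∣m; gcd[m,n]∣n)
open import Data.Nat.Properties
  using (≤-trans; m≤m+n; m≤n+m; <-irrefl; m+n≮m; *-assoc; *-identityʳ; *-zeroʳ;
         *-distribˡ-+; *-distribʳ-+; *-commutativeSemigroup)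
open import Algebra.Properties.CommutativeSemigroup *-commutativeSemigroup using (x∙yz≈y∙xz)
open import Data.Nat.Tactic.RingSolver using (solve)
open import Data.Product using (_×_; _,_; proj₁; proj₂; ∃-syntax)
open import Data.Vec using (Vec; []; _∷_; lookup; sum)
open import Data.Vec.Relation.Binary.Pointwise.Inductive as Pointwise using (Pointwise; []; _∷_)
open import Data.Vec.Relation.Unary.All using (All; []; _∷_)
open import Data.Vec.Relation.Unary.All.Properties using (lookup⁺)
open import Function using (_∘_)
open import Relation.Binary.PropositionalEquality
  using (_≡_; refl; sym; trans; cong; cong₂; subst; module ≡-Reasoning)
open import Relation.Nullary using (¬_; contradiction)

open import Defs

lookup≤sum : ∀ {k} (ys : Vec ℕ k) (i : Fin k) → lookup ys i ≤ sum ys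
lookup≤sum (y ∷ ys) zero    = m≤m+n y (sum ys)
lookup≤sum (y ∷ ys) (suc i) = ≤-trans (lookup≤sum ys i) (m≤n+m (sum ys) y)

module Modulo (n : ℕ) .{{_ : NonZero n}} where
  open ≡-Reasoning

  CoordWitness : ℕ → ℕ → ℕ → Set
  CoordWitness g x y = ∃[ q ] y * g ≡ x + q * n

  CoordWitness⇒%≡ : ∀ {g x y} → CoordWitness g x y → (y * g) % n ≡ x % n
  CoordWitness⇒%≡ {x = x} (q , eq) = trans (cong (_% n) eq) ([m+kn]%n≡m%n x q n)

  unit⇒IsGenerator : ∀ {g c} → CoordWitness g 1 c → IsGenerator n g
  unit⇒IsGenerator {g} {c} (q , cg) x = x * c , CoordWitness⇒%≡ {g} {x} {x * c} (x * q , xc·g)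
    where
    xc·g : x * c * g ≡ x + x * q * n
    xc·g = begin
      x * c * g       ≡⟨ *-assoc x c g ⟩
      x * (c * g)     ≡⟨ cong (x *_) cg ⟩
      x * (1 + q * n) ≡⟨ *-distribˡ-+ x 1 (q * n) ⟩
      x * 1 + x * (q * n) ≡⟨ cong₂ _+_ (*-identityʳ x) (sym (*-assoc x q n)) ⟩
      x + x * q * n   ∎

  sum*%≡sum% : ∀ {k} g (ys S : Vec ℕ k) →
    (∀ i → (lookup ys i * g) % n ≡ lookup S i % n) → (sum ys * g) % n ≡ sum S % n
  sum*%≡sum% g []       []       _  = refl
  sum*%≡sum% g (y ∷ ys) (x ∷ xs) eq = begin
    ((y + sum ys) * g) % n                ≡⟨ cong (_% n) (*-distribʳ-+ g y (sum ys)) ⟩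
    (y * g + sum ys * g) % n              ≡⟨ %-distribˡ-+ (y * g) (sum ys * g) n ⟩
    ((y * g) % n + (sum ys * g) % n) % n
      ≡⟨ cong₂ (λ a b → (a + b) % n) (eq zero) (sum*%≡sum% g ys xs (λ i → eq (suc i))) ⟩
    (x % n + sum xs % n) % n              ≡⟨ %-distribˡ-+ x (sum xs) n ⟨
    (x + sum xs) % n                      ∎

  -- Multiply by the c with c·g ≡ 1 that the generator provides.
  IsGenerator⇒cancel : ∀ {g} s → IsGenerator n g → (s * g) % n ≡ 0 → s % n ≡ 0
  IsGenerator⇒cancel {g} s gen sg≡0 with gen 1
  ... | c , cg≡1 = begin
    s % n                         ≡⟨ cong (_% n) (*-identityʳ s) ⟨
    (s * 1) % n                   ≡⟨ %-distribˡ-* s 1 n ⟩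
    (s % n * (1 % n)) % n         ≡⟨ cong (λ a → (s % n * a) % n) cg≡1 ⟨
    (s % n * ((c * g) % n)) % n   ≡⟨ %-distribˡ-* s (c * g) n ⟨
    (s * (c * g)) % n             ≡⟨ cong (_% n) (x∙yz≈y∙xz s c g) ⟩
    (c * (s * g)) % n             ≡⟨ %-distribˡ-* c (s * g) n ⟩
    (c % n * ((s * g) % n)) % n   ≡⟨ cong (λ a → (c % n * a) % n) sg≡0 ⟩
    (c % n * 0) % n               ≡⟨ cong (_% n) (*-zeroʳ (c % n)) ⟩
    0 % n                         ≡⟨ m*n%n≡0 0 n ⟩
    0                             ∎

  positive-multiple⇒≤ : ∀ s → 1 ≤ s → s % n ≡ 0 → n ≤ s
  positive-multiple⇒≤ s 1≤s s%n≡0 = ∣⇒≤ {{>-nonZero 1≤s}} (m%n≡0⇒n∣m s n s%n≡0)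

  n≤GNormSum : ∀ {k g s} (S : Vec ℕ (suc k)) → ZeroSum n S → IsGenerator n g →
    GNormSum n g S s → n ≤ s
  n≤GNormSum {g = g} S zs gen (ys , coords , refl) =
    positive-multiple⇒≤ (sum ys)
      (≤-trans (proj₁ (coords zero)) (lookup≤sum ys zero))
      (IsGenerator⇒cancel (sum ys) gen
        (trans (sum*%≡sum% g ys S (λ i → proj₂ (proj₂ (coords i)))) zs))

  sum₄≡ : ∀ a b c d → a + b + c + d ≡ n → sum (a ∷ b ∷ c ∷ d ∷ []) ≡ n
  sum₄≡ a b c d = trans reassociate
    where
    reassociate : a + (b + (c + (d + 0))) ≡ a + b + c + d
    reassociate = solve (a List.∷ b List.∷ c List.∷ d List.∷ List.[])

  -- The coordinate of the leading term 1 is an inverse of g, so g is a generator.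
  IndexOne-intro : ∀ {k} g (S : Vec ℕ k) (ys : Vec ℕ (suc k)) → ZeroSum n (1 ∷ S) →
    sum ys ≡ n → All (1 ≤_) ys → Pointwise (CoordWitness g) (1 ∷ S) ys → IndexOne n (1 ∷ S)
  IndexOne-intro g S ys@(c ∷ _) zs sum≡n positive coords@(unit ∷ _) =
    (g , unit⇒IsGenerator {g} {c} unit , ys , isCoord , sum≡n) , λ _ _ → n≤GNormSum (1 ∷ S) zs
    where
    isCoord : ∀ i → IsCoord n g (lookup (1 ∷ S) i) (lookup ys i)
    isCoord i = lookup⁺ positive i
              , subst (lookup ys i ≤_) sum≡n (lookup≤sum ys i)
              , CoordWitness⇒%≡ {g} {lookup (1 ∷ S) i} {lookup ys i} (Pointwise.lookup coords i)

seqA-IndexOne-5+6m : ∀ n .{{_ : NonZero n}} m → n ≡ 5 + m * 6 →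
  ZeroSum n (seqA n) → IndexOne n (seqA n)
seqA-IndexOne-5+6m _ m refl zs =
  IndexOne-intro 6 (1 + m * 6 ∷ 2 + m * 6 ∷ 6 ∷ []) (1 + m ∷ 1 + 2 * m ∷ 2 + 3 * m ∷ 1 ∷ []) zs
    (sum₄≡ (1 + m) (1 + 2 * m) (2 + 3 * m) 1 (solve List.[ m ]))
    (s≤s z≤n ∷ s≤s z≤n ∷ s≤s z≤n ∷ s≤s z≤n ∷ [])
    ((1 , solve List.[ m ]) ∷ (1 , solve List.[ m ]) ∷ (2 , solve List.[ m ]) ∷ (0 , refl) ∷ [])
  where open Modulo (5 + m * 6)

seqA-IndexOne-13+12m : ∀ m → let n = 13 + m * 12 in ZeroSum n (seqA n) → IndexOne n (seqA n)
seqA-IndexOne-13+12m m zs =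
  IndexOne-intro (9 + m * 12) (9 + m * 12 ∷ 10 + m * 12 ∷ 6 ∷ [])
    (3 + 3 * m ∷ 1 ∷ 4 + 3 * m ∷ 5 + 6 * m ∷ []) zs
    (sum₄≡ (3 + 3 * m) 1 (4 + 3 * m) (5 + 6 * m) (solve List.[ m ]))
    (s≤s z≤n ∷ s≤s z≤n ∷ s≤s z≤n ∷ s≤s z≤n ∷ [])
    ((2 + 3 * m , solve List.[ m ]) ∷ (0 , solve List.[ m ]) ∷ (2 + 3 * m , solve List.[ m ])
      ∷ (3 + 6 * m , solve List.[ m ]) ∷ [])
  where open Modulo (13 + m * 12)

seqA-IndexOne-19+12m : ∀ m → let n = 19 + m * 12 in ZeroSum n (seqA n) → IndexOne n (seqA n)
seqA-IndexOne-19+12m m zs =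
  IndexOne-intro (5 + 4 * m) (15 + m * 12 ∷ 16 + m * 12 ∷ 6 ∷ [])
    (4 + 3 * m ∷ 3 ∷ 7 + 3 * m ∷ 5 + 6 * m ∷ []) zs
    (sum₄≡ (4 + 3 * m) 3 (7 + 3 * m) (5 + 6 * m) (solve List.[ m ]))
    (s≤s z≤n ∷ s≤s z≤n ∷ s≤s z≤n ∷ s≤s z≤n ∷ [])
    ((1 + m , solve List.[ m ]) ∷ (0 , solve List.[ m ]) ∷ (1 + m , solve List.[ m ])
      ∷ (1 + 2 * m , solve List.[ m ]) ∷ [])
  where open Modulo (19 + m * 12)

seqB-IndexOne-7+4m : ∀ n .{{_ : NonZero n}} m → n ≡ 7 + m * 4 →
  ZeroSum n (seqB n) → IndexOne n (seqB n)
seqB-IndexOne-7+4m _ m refl zs =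
  IndexOne-intro 4 (4 + m * 4 ∷ 5 + m * 4 ∷ 4 ∷ []) (2 + m ∷ 1 + m ∷ 3 + 2 * m ∷ 1 ∷ []) zs
    (sum₄≡ (2 + m) (1 + m) (3 + 2 * m) 1 (solve List.[ m ]))
    (s≤s z≤n ∷ s≤s z≤n ∷ s≤s z≤n ∷ s≤s z≤n ∷ [])
    ((1 , solve List.[ m ]) ∷ (0 , solve List.[ m ]) ∷ (1 , solve List.[ m ]) ∷ (0 , refl) ∷ [])
  where open Modulo (7 + m * 4)

seqB-IndexOne-13+12m : ∀ m → let n = 13 + m * 12 in ZeroSum n (seqB n) → IndexOne n (seqB n)
seqB-IndexOne-13+12m m zs =
  IndexOne-intro (10 + m * 12) (10 + m * 12 ∷ 11 + m * 12 ∷ 4 ∷ [])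
    (4 + 4 * m ∷ 1 ∷ 5 + 4 * m ∷ 3 + 4 * m ∷ []) zs
    (sum₄≡ (4 + 4 * m) 1 (5 + 4 * m) (3 + 4 * m) (solve List.[ m ]))
    (s≤s z≤n ∷ s≤s z≤n ∷ s≤s z≤n ∷ s≤s z≤n ∷ [])
    ((3 + 4 * m , solve List.[ m ]) ∷ (0 , solve List.[ m ]) ∷ (3 + 4 * m , solve List.[ m ])
      ∷ (2 + 4 * m , solve List.[ m ]) ∷ [])
  where open Modulo (13 + m * 12)

seqB-IndexOne-17+12m : ∀ m → let n = 17 + m * 12 in ZeroSum n (seqB n) → IndexOne n (seqB n)
seqB-IndexOne-17+12m m zs =
  IndexOne-intro (7 + 6 * m) (14 + m * 12 ∷ 15 + m * 12 ∷ 4 ∷ [])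
    (5 + 4 * m ∷ 2 ∷ 7 + 4 * m ∷ 3 + 4 * m ∷ []) zs
    (sum₄≡ (5 + 4 * m) 2 (7 + 4 * m) (3 + 4 * m) (solve List.[ m ]))
    (s≤s z≤n ∷ s≤s z≤n ∷ s≤s z≤n ∷ s≤s z≤n ∷ [])
    ((2 + 2 * m , solve List.[ m ]) ∷ (0 , solve List.[ m ]) ∷ (2 + 2 * m , solve List.[ m ])
      ∷ (1 + 2 * m , solve List.[ m ]) ∷ [])
  where open Modulo (17 + m * 12)

¬EntriesIn-1 : ∀ {k} (S : Vec ℕ (suc k)) → ¬ EntriesIn 1 S
¬EntriesIn-1 S entries with entries zero
... | 1≤x , x<1 = <-irrefl refl (≤-trans (s≤s 1≤x) x<1)

seqA-7-not-minimal : ¬ MinimalZeroSum 7 (seqA 7)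
seqA-7-not-minimal (_ , minimal) = minimal (false ∷ true ∷ true ∷ false ∷ []) (λ ()) (λ ()) refl

seqB-5-not-minimal : ¬ MinimalZeroSum 5 (seqB 5)
seqB-5-not-minimal (_ , minimal) = minimal (false ∷ true ∷ true ∷ false ∷ []) (λ ()) (λ ()) refl

data Coprime6Residue : ℕ → Set where
  1+12u  : ∀ u → Coprime6Residue (1 + u * 12)
  5+12u  : ∀ u → Coprime6Residue (5 + u * 12)
  7+12u  : ∀ u → Coprime6Residue (7 + u * 12)
  11+12u : ∀ u → Coprime6Residue (11 + u * 12)

gcd[r+u*12,6]≡1⇒gcd[r,6]≡1 : ∀ r u → gcd (r + u * 12) 6 ≡ 1 → gcd r 6 ≡ 1
gcd[r+u*12,6]≡1⇒gcd[r,6]≡1 r u gcd≡1 = ∣1⇒≡1 (subst (gcd r 6 ∣_) gcd≡1 (gcd-greatest d∣r+u*12 d∣6))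
  where
  d∣6 : gcd r 6 ∣ 6
  d∣6 = gcd[m,n]∣n r 6
  d∣r+u*12 : gcd r 6 ∣ r + u * 12
  d∣r+u*12 = ∣m∣n⇒∣m+n (gcd[m,n]∣m r 6) (∣n⇒∣m*n u (∣-trans d∣6 (divides 2 refl)))

residue-view : ∀ r u → r < 12 → gcd r 6 ≡ 1 → Coprime6Residue (r + u * 12)
residue-view 0  u _ ()
residue-view 1  u _ _ = 1+12u u
residue-view 2  u _ ()
residue-view 3  u _ ()
residue-view 4  u _ ()
residue-view 5  u _ _ = 5+12u u
residue-view 6  u _ ()
residue-view 7  u _ _ = 7+12u u
residue-view 8  u _ ()
residue-view 9  u _ ()
residue-view 10 u _ ()
residue-view 11 u _ _ = 11+12u u
residue-view (suc (suc (suc (suc (suc (suc (suc (suc (suc (suc (suc (suc r)))))))))))) u r<12 _ =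
  contradiction r<12 (m+n≮m 12 r)

coprime6-residue : ∀ n → gcd n 6 ≡ 1 → Coprime6Residue n
coprime6-residue n gcd≡1 = subst Coprime6Residue (sym n≡r+u*12)
  (residue-view (n % 12) (n / 12) (m%n<n n 12)
    (gcd[r+u*12,6]≡1⇒gcd[r,6]≡1 (n % 12) (n / 12) (subst (λ k → gcd k 6 ≡ 1) n≡r+u*12 gcd≡1)))
  where
  n≡r+u*12 : n ≡ n % 12 + n / 12 * 12
  n≡r+u*12 = m≡m%n+[m/n]*n n 12

seqA-IndexOne : ∀ {n} .{{_ : NonZero n}} → Coprime6Residue n →
  EntriesIn n (seqA n) → MinimalZeroSum n (seqA n) → IndexOne n (seqA n)
seqA-IndexOne (1+12u zero)    entries _ = contradiction entries (¬EntriesIn-1 (seqA 1))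
seqA-IndexOne (1+12u (suc m)) _ = seqA-IndexOne-13+12m m ∘ proj₁
seqA-IndexOne (5+12u u)       _ = seqA-IndexOne-5+6m (5 + u * 12) (u * 2) (solve List.[ u ]) ∘ proj₁
seqA-IndexOne (7+12u zero)    _ minimal = contradiction minimal seqA-7-not-minimal
seqA-IndexOne (7+12u (suc m)) _ = seqA-IndexOne-19+12m m ∘ proj₁
seqA-IndexOne (11+12u u)      _ =
  seqA-IndexOne-5+6m (11 + u * 12) (1 + u * 2) (solve List.[ u ]) ∘ proj₁

seqB-IndexOne : ∀ {n} .{{_ : NonZero n}} → Coprime6Residue n →
  EntriesIn n (seqB n) → MinimalZeroSum n (seqB n) → IndexOne n (seqB n)
seqB-IndexOne (1+12u zero)    entries _ = contradiction entries (¬EntriesIn-1 (seqB 1))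
seqB-IndexOne (1+12u (suc m)) _ = seqB-IndexOne-13+12m m ∘ proj₁
seqB-IndexOne (5+12u zero)    _ minimal = contradiction minimal seqB-5-not-minimal
seqB-IndexOne (5+12u (suc m)) _ = seqB-IndexOne-17+12m m ∘ proj₁
seqB-IndexOne (7+12u u)       _ = seqB-IndexOne-7+4m (7 + u * 12) (u * 3) (solve List.[ u ]) ∘ proj₁
seqB-IndexOne (11+12u u)      _ =
  seqB-IndexOne-7+4m (11 + u * 12) (1 + u * 3) (solve List.[ u ]) ∘ proj₁

theorem2 : (n : ℕ) .{{_ : NonZero n}} → gcd n 6 ≡ 1 →
    ((EntriesIn n (seqA n) → MinimalZeroSum n (seqA n) → IndexOne n (seqA n)) ×
    (EntriesIn n (seqB n) → MinimalZeroSum n (seqB n) → IndexOne n (seqB n)))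
theorem2 n gcd≡1 = seqA-IndexOne residue , seqB-IndexOne residue
  where
  residue : Coprime6Residue n
  residue = coprime6-residue n gcd≡1
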